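{- There exists a skew-Hadamard matrix of order $1252=2(5^4+1)$.
   Context: A skew-Hadamard matrix of order $n$ is an $n\times n$ matrix $H$ with entries in $\{+1,-1\}$ satisfying $HH^T=nI_n$ and $H+H^T=2I_n$ (equivalently, $H-I_n$ is skew-symmetric). -}

module Defs where

open import Data.Nat using (ℕ; zero; suc)
open import Data.Integer using (ℤ; +_; -[1+_]; _+_; _*_)
open import Data.Fin using (Fin; zero; suc; _≟_)
open import Data.Sum using (_⊎_)
open import Data.Product using (_×_; Σ)
open import Relation.Binary.PropositionalEquality using (_≡_)
open import Relation.Nullary using (yes; no)

Matrix : ℕ → Set
Matrix n = Fin n → Fin n → ℤ

sumFin : ∀ {n} → (Fin n → ℤ) → ℤ
sumFin {zero}  f = + 0
sumFin {suc n} f = f zero + sumFin {n} (λ k → f (suc k))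

identity : ∀ {n} → Matrix n
identity i j with i ≟ j
... | yes _ = + 1
... | no  _ = + 0

transpose : ∀ {n} → Matrix n → Matrix n
transpose H i j = H j i

_⊗_ : ∀ {n} → Matrix n → Matrix n → Matrix n
(A ⊗ B) i j = sumFin (λ k → A i k * B k j)

_⊕_ : ∀ {n} → Matrix n → Matrix n → Matrix n
(A ⊕ B) i j = A i j + B i j

scale : ∀ {n} → ℤ → Matrix n → Matrix n
scale c A i j = c * A i j

record IsSkewHadamard (n : ℕ) (H : Matrix n) : Set where
  field
    entries  : ∀ i j → (H i j ≡ + 1) ⊎ (H i j ≡ -[1+ 0 ])
    hadamard : ∀ i j → (H ⊗ transpose H) i j ≡ scale (+ n) identity i j
    skew     : ∀ i j → (H ⊕ transpose H) i j ≡ scale (+ 2) identity i j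

SkewHadamardExists : ℕ → Set
SkewHadamardExists n = Σ (Matrix n) (IsSkewHadamard n)

-- Goethals–Seidel construction. Let a, b, c, d be ±1 sequences of period v whose periodic
-- autocorrelations sum to zero at every nonzero shift, and let a be skew: a 0 = 1 and
-- a k = - a (- k) for k ≢ 0 (mod v). From their circulants A, B, C, D and the back-diagonal
-- permutation matrix R the Goethals–Seidel array builds a ±1 matrix H of order 4v.
-- Circulants X, Y commute and X R Yᵀ = Y R Xᵀ, so the off-diagonal blocks of H Hᵀ cancel in pairs,
-- while every diagonal block is A Aᵀ + B Bᵀ + C Cᵀ + D Dᵀ = 4v I. Skewness of a gives
-- A + Aᵀ = 2 I, and the remaining blocks are placed antisymmetrically, so H + Hᵀ = 2 I.
-- For 1252 = 4 · 313 suitable sequences are given explicitly and checked by evaluation.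

{-# OPTIONS --safe #-}
module Submission where

open import Defs
open import Algebra.Bundles using (AbelianGroup)
open import Data.Bool using (Bool; true; false; _∧_)
open import Data.Bool.Properties using (∧-conicalˡ; ∧-conicalʳ)
open import Data.Empty using (⊥-elim)
open import Data.Fin using (Fin; zero; suc; toℕ; _≟_; _↑ˡ_; _↑ʳ_; combine; quotient; remainder)
open import Data.Fin.Patterns using (0F; 1F; 2F; 3F)
import Data.Fin.Properties as Finₚ
open import Data.Integer using (ℤ; +_; -[1+_]; _+_; _*_; -_; _-_; _⊖_)
import Data.Integer.Properties as ℤₚ
open import Data.Integer.Tactic.RingSolver using (solve; solve-∀)
open import Data.List using (_∷_; [])
open import Data.Nat as ℕ using (ℕ; zero; suc; _∸_)
open import Data.Nat.DivMod using (_%_; _/_; [m+n]%n≡m%n; m<n⇒m%n≡m)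
import Data.Nat.Properties as ℕₚ
open import Data.Product using (_,_; proj₁; proj₂)
open import Data.Sum using (_⊎_; inj₁; inj₂)
open import Function using (_∘_)
open import Relation.Binary.Definitions using (tri<; tri≈; tri>)
open import Relation.Binary.PropositionalEquality
open import Relation.Nullary using (yes; no)

open import Algebra.Properties.Group (AbelianGroup.group ℤₚ.+-0-abelianGroup) using (∙-cancelˡ)
open ≡-Reasoning

sumℕ : ℕ → (ℕ → ℤ) → ℤ
sumℕ zero    g = + 0
sumℕ (suc n) g = g 0 + sumℕ n (g ∘ suc)

sumℕ-cong : ∀ n {g h : ℕ → ℤ} → (∀ k → g k ≡ h k) → sumℕ n g ≡ sumℕ n h
sumℕ-cong zero    g≗h = refl
sumℕ-cong (suc n) g≗h = cong₂ _+_ (g≗h 0) (sumℕ-cong n (g≗h ∘ suc))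

sumℕ-snoc : ∀ n g → sumℕ (suc n) g ≡ sumℕ n g + g n
sumℕ-snoc zero    g = ℤₚ.+-comm (g 0) (+ 0)
sumℕ-snoc (suc n) g = begin
  g 0 + sumℕ (suc n) (g ∘ suc)   ≡⟨ cong (_+_ (g 0)) (sumℕ-snoc n (g ∘ suc)) ⟩
  g 0 + (sumℕ n (g ∘ suc) + g (suc n)) ≡⟨ ℤₚ.+-assoc (g 0) _ _ ⟨
  sumℕ (suc n) g + g (suc n)     ∎

sumℕ-neg : ∀ n g → sumℕ n (-_ ∘ g) ≡ - sumℕ n g
sumℕ-neg zero    g = refl
sumℕ-neg (suc n) g = begin
  - g 0 + sumℕ n (-_ ∘ g ∘ suc) ≡⟨ cong (_+_ (- g 0)) (sumℕ-neg n (g ∘ suc)) ⟩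
  - g 0 + - sumℕ n (g ∘ suc)    ≡⟨ ℤₚ.neg-distrib-+ (g 0) _ ⟨
  - sumℕ (suc n) g              ∎

sumℕ-const : ∀ n → sumℕ n (λ _ → + 1) ≡ + n
sumℕ-const zero    = refl
sumℕ-const (suc n) = cong (_+_ (+ 1)) (sumℕ-const n)

sumℕ-reverse : ∀ n (f : ℤ → ℤ) c →
               sumℕ n (λ k → f (c - + k)) ≡ sumℕ n (λ k → f (c - + n + + suc k))
sumℕ-reverse zero    f c = refl
sumℕ-reverse (suc n) f c = begin
  f (c - + 0) + sumℕ n (λ k → f (c - + suc k))
    ≡⟨ cong₂ _+_ (cong f (ℤₚ.+-identityʳ c)) (sumℕ-cong n λ k → cong f (step (+ k))) ⟩
  f c + sumℕ n (λ k → f (c - + 1 - + k))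
    ≡⟨ cong (_+_ (f c)) (sumℕ-reverse n f (c - + 1)) ⟩
  f c + sumℕ n (λ k → f (c - + 1 - + n + + suc k))
    ≡⟨ ℤₚ.+-comm (f c) _ ⟩
  sumℕ n (λ k → f (c - + 1 - + n + + suc k)) + f c
    ≡⟨ cong₂ _+_ (sumℕ-cong n λ k → cong f (shifted (+ n) (+ k))) (cong f (last (+ n))) ⟩
  sumℕ n (λ k → f (c - + suc n + + suc k)) + f (c - + suc n + + suc n)
    ≡⟨ sumℕ-snoc n (λ k → f (c - + suc n + + suc k)) ⟨
  sumℕ (suc n) (λ k → f (c - + suc n + + suc k)) ∎
  where
  step : ∀ z → c - (+ 1 + z) ≡ c - + 1 - z
  step z = solve (c ∷ z ∷ [])
  shifted : ∀ m z → c - + 1 - m + (+ 1 + z) ≡ c - (+ 1 + m) + (+ 1 + z)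
  shifted m z = solve (c ∷ m ∷ z ∷ [])
  last : ∀ m → c ≡ c - (+ 1 + m) + (+ 1 + m)
  last m = solve (c ∷ m ∷ [])

i-j≡-[j-i] : ∀ i j → i - j ≡ - (j - i)
i-j≡-[j-i] = solve-∀

i≡j⇒-i+j≡0 : ∀ {i j} → i ≡ j → - i + j ≡ + 0
i≡j⇒-i+j≡0 {i} {j} i≡j = trans (ℤₚ.+-comm (- i) j) (ℤₚ.i≡j⇒i-j≡0 (sym i≡j))

IsSign : ℤ → Set
IsSign z = z ≡ + 1 ⊎ z ≡ -[1+ 0 ]

IsSign-neg : ∀ {z} → IsSign z → IsSign (- z)
IsSign-neg (inj₁ refl) = inj₂ refl
IsSign-neg (inj₂ refl) = inj₁ refl

IsSign-square : ∀ {z} → IsSign z → z * z ≡ + 1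
IsSign-square (inj₁ refl) = refl
IsSign-square (inj₂ refl) = refl

symmetrisation-even : ∀ (f : ℤ → ℤ) z → f (- z) + f (- - z) ≡ f z + f (- z)
symmetrisation-even f z =
  trans (cong (_+_ (f (- z))) (cong f (ℤₚ.neg-involutive z))) (ℤₚ.+-comm (f (- z)) (f z))

sumFin-const : ∀ n m → sumFin {n} (λ _ → + m) ≡ + (n ℕ.* m)
sumFin-const zero    m = refl
sumFin-const (suc n) m = cong (_+_ (+ m)) (sumFin-const n m)

sumFin-toℕ : ∀ n (g : ℕ → ℤ) → sumFin {n} (λ k → g (toℕ k)) ≡ sumℕ n g
sumFin-toℕ zero    g = refl
sumFin-toℕ (suc n) g = cong (_+_ (g 0)) (sumFin-toℕ n (g ∘ suc))

sumFin-cong : ∀ {n} {f g : Fin n → ℤ} → (∀ k → f k ≡ g k) → sumFin f ≡ sumFin g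
sumFin-cong {zero}  f≗g = refl
sumFin-cong {suc n} f≗g = cong₂ _+_ (f≗g zero) (sumFin-cong (f≗g ∘ suc))

sumFin-↑ : ∀ m {n} (f : Fin (m ℕ.+ n) → ℤ) →
           sumFin f ≡ sumFin (λ i → f (i ↑ˡ n)) + sumFin (λ j → f (m ↑ʳ j))
sumFin-↑ zero    f = sym (ℤₚ.+-identityˡ _)
sumFin-↑ (suc m) f = trans (cong (_+_ (f zero)) (sumFin-↑ m (f ∘ suc))) (sym (ℤₚ.+-assoc (f zero) _ _))

sumFin-combine : ∀ m {n} (f : Fin (m ℕ.* n) → ℤ) →
                 sumFin f ≡ sumFin {m} (λ p → sumFin {n} (λ i → f (combine p i)))
sumFin-combine zero        f = refl
sumFin-combine (suc m) {n} f =
  trans (sumFin-↑ n f) (cong (_+_ (sumFin (λ i → f (i ↑ˡ m ℕ.* n)))) (sumFin-combine m (λ j → f (n ↑ʳ j))))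

sum₄-cong : ∀ {a₀ a₁ a₂ a₃ b₀ b₁ b₂ b₃ : ℤ} → a₀ ≡ b₀ → a₁ ≡ b₁ → a₂ ≡ b₂ → a₃ ≡ b₃ →
            a₀ + (a₁ + (a₂ + (a₃ + + 0))) ≡ b₀ + (b₁ + (b₂ + (b₃ + + 0)))
sum₄-cong refl refl refl refl = refl

blockMatrix : ∀ {m} n → (Fin m → Fin m → Fin n → Fin n → ℤ) → Matrix (m ℕ.* n)
blockMatrix {m} n B x y = B (quotient n x) (quotient n y) (remainder {m} n x) (remainder {m} n y)

module _ {m n : ℕ} (B : Fin m → Fin m → Fin n → Fin n → ℤ) where

  blockMatrix-combine : ∀ p i q k → blockMatrix n B (combine p i) (combine q k) ≡ B p q i k
  blockMatrix-combine p i q k =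
    cong₂ (λ x y → B (proj₁ x) (proj₁ y) (proj₂ x) (proj₂ y))
          (Finₚ.remQuot-combine p i) (Finₚ.remQuot-combine q k)

  blockMatrix-⊗-transpose : ∀ p i p' i' →
    (blockMatrix n B ⊗ transpose (blockMatrix n B)) (combine p i) (combine p' i')
      ≡ sumFin (λ q → sumFin (λ k → B p q i k * B p' q i' k))
  blockMatrix-⊗-transpose p i p' i' = trans (sumFin-combine m _) (sumFin-cong λ q → sumFin-cong λ k →
    cong₂ _*_ (blockMatrix-combine p i q k) (blockMatrix-combine p' i' q k))

∀-combine : ∀ {m n} {P : Fin (m ℕ.* n) → Fin (m ℕ.* n) → Set} →
            (∀ p i q k → P (combine p i) (combine q k)) → ∀ x y → P x y
∀-combine {m} {n} h x y with Finₚ.combine-surjective {m} {n} x | Finₚ.combine-surjective {m} {n} y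
... | p , i , refl | q , k , refl = h p i q k

scale-identity-diagonal : ∀ {n} c (x : Fin n) → scale c identity x x ≡ c
scale-identity-diagonal c x with x ≟ x
... | yes _   = ℤₚ.*-identityʳ c
... | no x≢x = ⊥-elim (x≢x refl)

scale-identity-offDiagonal : ∀ {n} c {x y : Fin n} → x ≢ y → scale c identity x y ≡ + 0
scale-identity-offDiagonal c {x} {y} x≢y with x ≟ y
... | yes x≡y = ⊥-elim (x≢y x≡y)
... | no _    = ℤₚ.*-zeroʳ c

-- A v-periodic function ℤ → ℤ stands for a sequence indexed by ℤ/vℤ, and ∑ sums it over a period.
module PeriodicSums (v : ℕ) where

  Periodic : (ℤ → ℤ) → Set
  Periodic f = ∀ z → f (z + + v) ≡ f z

  periodic-backwards : ∀ {f} → Periodic f → ∀ z → f (z - + v) ≡ f z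
  periodic-backwards {f} p z = begin
    f (z - + v)         ≡⟨ p (z - + v) ⟨
    f (z - + v + + v)   ≡⟨ cong f (m-n+n≡m z (+ v)) ⟩
    f z                 ∎
    where
    m-n+n≡m : ∀ m n → m - n + n ≡ m
    m-n+n≡m = solve-∀

  shift-periodic : ∀ {f} → Periodic f → ∀ c → Periodic (λ z → f (z + c))
  shift-periodic {f} p c z = begin
    f (z + + v + c)  ≡⟨ cong f (swap z (+ v) c) ⟩
    f (z + c + + v)  ≡⟨ p (z + c) ⟩
    f (z + c)        ∎
    where
    swap : ∀ x y z → x + y + z ≡ x + z + y
    swap = solve-∀

  reflect-periodic : ∀ {f} → Periodic f → ∀ c → Periodic (λ z → f (c - z))
  reflect-periodic {f} p c z = begin
    f (c - (z + + v))  ≡⟨ cong f (sub-+ c z (+ v)) ⟩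
    f (c - z - + v)    ≡⟨ periodic-backwards p (c - z) ⟩
    f (c - z)          ∎
    where
    sub-+ : ∀ x y z → x - (y + z) ≡ x - y - z
    sub-+ = solve-∀

  *-periodic : ∀ {f g} → Periodic f → Periodic g → Periodic (λ z → f z * g z)
  *-periodic pf pg z = cong₂ _*_ (pf z) (pg z)

  ∑ : (ℤ → ℤ) → ℤ
  ∑ f = sumℕ v (λ k → f (+ k))

  ∑-cong : ∀ {f g} → (∀ z → f z ≡ g z) → ∑ f ≡ ∑ g
  ∑-cong f≗g = sumℕ-cong v (f≗g ∘ +_)

  ∑-neg : ∀ f → ∑ (λ z → - f z) ≡ - ∑ f
  ∑-neg f = sumℕ-neg v (f ∘ +_)

  ∑-shift-suc : ∀ {f} → Periodic f → ∀ c → ∑ (λ z → f (z + (+ 1 + c))) ≡ ∑ (λ z → f (z + c))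
  ∑-shift-suc {f} p c = ∙-cancelˡ (g 0) _ _ (begin
    g 0 + ∑ (λ z → f (z + (+ 1 + c)))  ≡⟨ cong (_+_ (g 0)) (sumℕ-cong v λ k → cong f (reassoc (+ k))) ⟩
    sumℕ (suc v) g                     ≡⟨ sumℕ-snoc v g ⟩
    ∑ (λ z → f (z + c)) + g v          ≡⟨ cong (_+_ (∑ (λ z → f (z + c)))) wrap ⟩
    ∑ (λ z → f (z + c)) + g 0          ≡⟨ ℤₚ.+-comm _ (g 0) ⟩
    g 0 + ∑ (λ z → f (z + c))          ∎)
    where
    g : ℕ → ℤ
    g k = f (+ k + c)
    reassoc : ∀ z → z + (+ 1 + c) ≡ + 1 + z + c
    reassoc z = solve (z ∷ c ∷ [])
    wrap : g v ≡ g 0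
    wrap = begin
      f (+ v + c)   ≡⟨ cong f (ℤₚ.+-comm (+ v) c) ⟩
      f (c + + v)   ≡⟨ p c ⟩
      f c           ≡⟨ cong f (ℤₚ.+-identityˡ c) ⟨
      f (+ 0 + c)   ∎

  ∑-shift : ∀ {f} → Periodic f → ∀ c → ∑ (λ z → f (z + c)) ≡ ∑ f
  ∑-shift {f} p (+ n) = shift-ℕ n
    where
    shift-ℕ : ∀ n → ∑ (λ z → f (z + + n)) ≡ ∑ f
    shift-ℕ zero    = ∑-cong (cong f ∘ ℤₚ.+-identityʳ)
    shift-ℕ (suc n) = trans (∑-shift-suc p (+ n)) (shift-ℕ n)
  ∑-shift {f} p -[1+ n ] = begin
    ∑ (λ z → f (z + -[1+ n ]))            ≡⟨ ∑-shift (shift-periodic p -[1+ n ]) (+ suc n) ⟨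
    ∑ (λ z → f (z + + suc n + -[1+ n ]))  ≡⟨ ∑-cong (λ z → cong f (cancel z (+ suc n))) ⟩
    ∑ f                                   ∎
    where
    cancel : ∀ z m → z + m - m ≡ z
    cancel = solve-∀

  ∑-reflect : ∀ {f} → Periodic f → ∀ c → ∑ (λ z → f (c - z)) ≡ ∑ f
  ∑-reflect {f} p c = begin
    ∑ (λ z → f (c - z))                    ≡⟨ sumℕ-reverse v f c ⟩
    sumℕ v (λ k → f (c - + v + + suc k))   ≡⟨ sumℕ-cong v (λ k → cong f (reassoc c (+ v) (+ k))) ⟩
    ∑ (λ z → f (z + (c - + v + + 1)))      ≡⟨ ∑-shift p (c - + v + + 1) ⟩
    ∑ f                                    ∎
    where
    reassoc : ∀ c m z → c - m + (+ 1 + z) ≡ z + (c - m + + 1)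
    reassoc = solve-∀

  ∑-negˡ : ∀ (f g : ℤ → ℤ) → ∑ (λ z → - f z * g z) ≡ - ∑ (λ z → f z * g z)
  ∑-negˡ f g = begin
    ∑ (λ z → - f z * g z)    ≡⟨ ∑-cong (λ z → ℤₚ.neg-distribˡ-* (f z) (g z)) ⟨
    ∑ (λ z → - (f z * g z))  ≡⟨ ∑-neg (λ z → f z * g z) ⟩
    - ∑ (λ z → f z * g z)    ∎

  ∑-negʳ : ∀ (f g : ℤ → ℤ) → ∑ (λ z → f z * - g z) ≡ - ∑ (λ z → f z * g z)
  ∑-negʳ f g = begin
    ∑ (λ z → f z * - g z)    ≡⟨ ∑-cong (λ z → ℤₚ.neg-distribʳ-* (f z) (g z)) ⟨
    ∑ (λ z → - (f z * g z))  ≡⟨ ∑-neg (λ z → f z * g z) ⟩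
    - ∑ (λ z → f z * g z)    ∎

  ∑-neg-neg : ∀ (f g : ℤ → ℤ) → ∑ (λ z → - f z * - g z) ≡ ∑ (λ z → f z * g z)
  ∑-neg-neg f g = begin
    ∑ (λ z → - f z * - g z)    ≡⟨ ∑-negˡ f (λ z → - g z) ⟩
    - ∑ (λ z → f z * - g z)    ≡⟨ cong -_ (∑-negʳ f g) ⟩
    - - ∑ (λ z → f z * g z)    ≡⟨ ℤₚ.neg-involutive _ ⟩
    ∑ (λ z → f z * g z)        ∎

  correlation : (ℤ → ℤ) → (ℤ → ℤ) → ℤ → ℤ
  correlation x y c = ∑ (λ z → x z * y (z + c))

  convolution : (ℤ → ℤ) → (ℤ → ℤ) → ℤ → ℤ
  convolution x y c = ∑ (λ z → x z * y (c - z))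

  module _ {x y : ℤ → ℤ} (px : Periodic x) (py : Periodic y) where

    ∑-correlation : ∀ u w → ∑ (λ z → x (z + u) * y (z + w)) ≡ correlation x y (w - u)
    ∑-correlation u w = begin
      ∑ (λ z → x (z + u) * y (z + w))              ≡⟨ ∑-cong (λ z → cong (λ t → x (z + u) * y t) (shift z u w)) ⟩
      ∑ (λ z → x (z + u) * y (z + u + (w - u)))    ≡⟨ ∑-shift (*-periodic px (shift-periodic py (w - u))) u ⟩
      correlation x y (w - u)                      ∎
      where
      shift : ∀ z u w → z + w ≡ z + u + (w - u)
      shift = solve-∀

    ∑-correlation-reflected : ∀ u w → ∑ (λ z → x (u - z) * y (w - z)) ≡ correlation x y (w - u)
    ∑-correlation-reflected u w = begin
      ∑ (λ z → x (u - z) * y (w - z))              ≡⟨ ∑-cong (λ z → cong (λ t → x (u - z) * y t) (shift z u w)) ⟩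
      ∑ (λ z → x (u - z) * y (u - z + (w - u)))    ≡⟨ ∑-reflect (*-periodic px (shift-periodic py (w - u))) u ⟩
      correlation x y (w - u)                      ∎
      where
      shift : ∀ z u w → w - z ≡ u - z + (w - u)
      shift = solve-∀

    ∑-convolution : ∀ u w → ∑ (λ z → x (z + u) * y (w - z)) ≡ convolution x y (u + w)
    ∑-convolution u w = begin
      ∑ (λ z → x (z + u) * y (w - z))              ≡⟨ ∑-cong (λ z → cong (λ t → x (z + u) * y t) (shift z u w)) ⟩
      ∑ (λ z → x (z + u) * y (u + w - (z + u)))    ≡⟨ ∑-shift (*-periodic px (reflect-periodic py (u + w))) u ⟩
      convolution x y (u + w)                      ∎
      where
      shift : ∀ z u w → w - z ≡ u + w - (z + u)
      shift = solve-∀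

    ∑-convolution-reflected : ∀ u w → ∑ (λ z → x (u - z) * y (z + w)) ≡ convolution x y (u + w)
    ∑-convolution-reflected u w = begin
      ∑ (λ z → x (u - z) * y (z + w))              ≡⟨ ∑-cong (λ z → cong (λ t → x (u - z) * y t) (shift z u w)) ⟩
      ∑ (λ z → x (u - z) * y (u + w - (u - z)))    ≡⟨ ∑-reflect (*-periodic px (reflect-periodic py (u + w))) u ⟩
      convolution x y (u + w)                      ∎
      where
      shift : ∀ z u w → z + w ≡ u + w - (u - z)
      shift = solve-∀

    convolution-comm : ∀ c → convolution x y c ≡ convolution y x c
    convolution-comm c = begin
      ∑ (λ z → x z * y (c - z))
        ≡⟨ ∑-cong (λ z → trans (ℤₚ.*-comm (x z) (y (c - z))) (cong (λ t → y (c - z) * x t) (reflect² c z))) ⟩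
      ∑ (λ z → y (c - z) * x (c - (c - z)))
        ≡⟨ ∑-reflect (*-periodic py (reflect-periodic px c)) c ⟩
      convolution y x c ∎
      where
      reflect² : ∀ c z → z ≡ c - (c - z)
      reflect² = solve-∀

    correlation-swap : ∀ c → correlation x y c ≡ correlation y x (- c)
    correlation-swap c = begin
      ∑ (λ z → x z * y (z + c))
        ≡⟨ ∑-cong (λ z → trans (ℤₚ.*-comm (x z) (y (z + c))) (cong (λ t → y (z + c) * x t) (cancel z c))) ⟩
      ∑ (λ z → y (z + c) * x (z + c - c))
        ≡⟨ ∑-shift (*-periodic py (shift-periodic px (- c))) c ⟩
      correlation y x (- c) ∎
      where
      cancel : ∀ z c → z ≡ z + c - c
      cancel = solve-∀

  autocorrelationSum : ∀ {n} → (Fin n → ℤ → ℤ) → ℤ → ℤ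
  autocorrelationSum x c = sumFin (λ j → correlation (x j) (x j) c)

  autocorrelationSum-even : ∀ {n} {x : Fin n → ℤ → ℤ} → (∀ j → Periodic (x j)) →
                            ∀ c → autocorrelationSum x (- c) ≡ autocorrelationSum x c
  autocorrelationSum-even px c = sumFin-cong λ j → sym (correlation-swap (px j) (px j) c)

  autocorrelation-zero : ∀ {x} → (∀ z → IsSign (x z)) → correlation x x (+ 0) ≡ + v
  autocorrelation-zero {x} sign = begin
    ∑ (λ z → x z * x (z + + 0))
      ≡⟨ ∑-cong (λ z → trans (cong (λ t → x z * x t) (ℤₚ.+-identityʳ z)) (IsSign-square (sign z))) ⟩
    ∑ (λ _ → + 1)
      ≡⟨ sumℕ-const v ⟩
    + v ∎

  autocorrelationSum-zero : ∀ {n} {x : Fin n → ℤ → ℤ} → (∀ j z → IsSign (x j z)) →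
                            autocorrelationSum x (+ 0) ≡ + (n ℕ.* v)
  autocorrelationSum-zero {n} sign =
    trans (sumFin-cong λ j → autocorrelation-zero (sign j)) (sumFin-const n v)

  toℤ : Fin v → ℤ
  toℤ i = + toℕ i

  ∑-toℤ : ∀ f → sumFin (λ k → f (toℤ k)) ≡ ∑ f
  ∑-toℤ f = sumFin-toℕ v (λ n → f (+ n))

  module _ {F : ℤ → ℤ} (vanish : ∀ {s} → 0 ℕ.< s → s ℕ.< v → F (+ s) ≡ + 0) where

    difference-vanishes : ∀ {m n} → m ℕ.< n → n ℕ.< v → F (+ n - + m) ≡ + 0
    difference-vanishes {m} {n} m<n n<v = begin
      F (+ n - + m)   ≡⟨ cong F (trans (ℤₚ.m-n≡m⊖n n m) (ℤₚ.⊖-≥ (ℕₚ.<⇒≤ m<n))) ⟩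
      F (+ (n ∸ m))   ≡⟨ vanish (ℕₚ.m<n⇒0<n∸m m<n) (ℕₚ.≤-<-trans (ℕₚ.m∸n≤m n m) n<v) ⟩
      + 0             ∎

    differences-vanish : (∀ z → F (- z) ≡ F z) → ∀ {i k : Fin v} → i ≢ k → F (toℤ i - toℤ k) ≡ + 0
    differences-vanish even {i} {k} i≢k with ℕₚ.<-cmp (toℕ i) (toℕ k)
    ... | tri< i<k _ _ = begin
      F (toℤ i - toℤ k)      ≡⟨ cong F (i-j≡-[j-i] (toℤ i) (toℤ k)) ⟩
      F (- (toℤ k - toℤ i))  ≡⟨ even (toℤ k - toℤ i) ⟩
      F (toℤ k - toℤ i)      ≡⟨ difference-vanishes i<k (Finₚ.toℕ<n k) ⟩
      + 0                    ∎
    ... | tri≈ _ i≡k _ = ⊥-elim (i≢k (Finₚ.toℕ-injective i≡k))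
    ... | tri> _ _ k<i = difference-vanishes k<i (Finₚ.toℕ<n i)

module GoethalsSeidelArray {v : ℕ} (seq : Fin 4 → ℤ → ℤ)
                           (periodic : ∀ j → PeriodicSums.Periodic v (seq j)) where
  open PeriodicSums v

  -- Entries of the circulant X with first row x and of XR, XᵀR, where R is the
  -- back-diagonal permutation matrix; indices are read modulo v.
  circ circR circᵀR : (ℤ → ℤ) → ℤ → ℤ → ℤ
  circ   x i k = x (k - i)
  circR  x i k = x (- i - + 1 - k)
  circᵀR x i k = x (k + (i + + 1))

  module _ {x y : ℤ → ℤ} (px : Periodic x) (py : Periodic y) (i i' : ℤ) where

    circ·circ : ∑ (λ z → circ x i z * circ y i' z) ≡ correlation x y (i - i')
    circ·circ = trans (∑-correlation px py (- i) (- i')) (cong (correlation x y) (offset i i'))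
      where
      offset : ∀ i i' → - i' - - i ≡ i - i'
      offset = solve-∀

    circR·circR : ∑ (λ z → circR x i z * circR y i' z) ≡ correlation x y (i - i')
    circR·circR = trans (∑-correlation-reflected px py (- i - + 1) (- i' - + 1))
                        (cong (correlation x y) (offset i i'))
      where
      offset : ∀ i i' → - i' - + 1 - (- i - + 1) ≡ i - i'
      offset = solve-∀

    circᵀR·circᵀR : ∑ (λ z → circᵀR x i z * circᵀR y i' z) ≡ correlation y x (i - i')
    circᵀR·circᵀR = begin
      ∑ (λ z → circᵀR x i z * circᵀR y i' z)    ≡⟨ ∑-correlation px py (i + + 1) (i' + + 1) ⟩
      correlation x y (i' + + 1 - (i + + 1))    ≡⟨ correlation-swap px py (i' + + 1 - (i + + 1)) ⟩
      correlation y x (- (i' + + 1 - (i + + 1))) ≡⟨ cong (correlation y x) (offset i i') ⟩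
      correlation y x (i - i')                  ∎
      where
      offset : ∀ i i' → - (i' + + 1 - (i + + 1)) ≡ i - i'
      offset = solve-∀

    circ·circR : ∑ (λ z → circ x i z * circR y i' z) ≡ convolution x y (- i - i' - + 1)
    circ·circR = trans (∑-convolution px py (- i) (- i' - + 1)) (cong (convolution x y) (offset i i'))
      where
      offset : ∀ i i' → - i + (- i' - + 1) ≡ - i - i' - + 1
      offset = solve-∀

    circR·circ : ∑ (λ z → circR x i z * circ y i' z) ≡ convolution y x (- i - i' - + 1)
    circR·circ = begin
      ∑ (λ z → circR x i z * circ y i' z)   ≡⟨ ∑-convolution-reflected px py (- i - + 1) (- i') ⟩
      convolution x y (- i - + 1 + - i')    ≡⟨ convolution-comm px py (- i - + 1 + - i') ⟩
      convolution y x (- i - + 1 + - i')    ≡⟨ cong (convolution y x) (offset i i') ⟩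
      convolution y x (- i - i' - + 1)      ∎
      where
      offset : ∀ i i' → - i - + 1 + - i' ≡ - i - i' - + 1
      offset = solve-∀

    circR·circᵀR : ∑ (λ z → circR x i z * circᵀR y i' z) ≡ convolution x y (i' - i)
    circR·circᵀR = trans (∑-convolution-reflected px py (- i - + 1) (i' + + 1))
                         (cong (convolution x y) (offset i i'))
      where
      offset : ∀ i i' → - i - + 1 + (i' + + 1) ≡ i' - i
      offset = solve-∀

    circ·circᵀR : ∑ (λ z → circ x i z * circᵀR y i' z) ≡ correlation x y (i + i' + + 1)
    circ·circᵀR = trans (∑-correlation px py (- i) (i' + + 1)) (cong (correlation x y) (offset i i'))
      where
      offset : ∀ i i' → i' + + 1 - - i ≡ i + i' + + 1
      offset = solve-∀

    circᵀR·circ : ∑ (λ z → circᵀR x i z * circ y i' z) ≡ correlation y x (i + i' + + 1)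
    circᵀR·circ = begin
      ∑ (λ z → circᵀR x i z * circ y i' z)   ≡⟨ ∑-correlation px py (i + + 1) (- i') ⟩
      correlation x y (- i' - (i + + 1))     ≡⟨ correlation-swap px py (- i' - (i + + 1)) ⟩
      correlation y x (- (- i' - (i + + 1))) ≡⟨ cong (correlation y x) (offset i i') ⟩
      correlation y x (i + i' + + 1)         ∎
      where
      offset : ∀ i i' → - (- i' - (i + + 1)) ≡ i + i' + + 1
      offset = solve-∀

  a b c d : ℤ → ℤ
  a = seq 0F
  b = seq 1F
  c = seq 2F
  d = seq 3F

  pa : Periodic a
  pa = periodic 0F
  pb : Periodic b
  pb = periodic 1F
  pc : Periodic c
  pc = periodic 2F
  pd : Periodic d
  pd = periodic 3F

  array : Fin 4 → Fin 4 → ℤ → ℤ → ℤ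
  array 0F 0F i k = circ a i k
  array 0F 1F i k = circR b i k
  array 0F 2F i k = circR c i k
  array 0F 3F i k = circR d i k
  array 1F 0F i k = - circR b i k
  array 1F 1F i k = circ a i k
  array 1F 2F i k = circᵀR d i k
  array 1F 3F i k = - circᵀR c i k
  array 2F 0F i k = - circR c i k
  array 2F 1F i k = - circᵀR d i k
  array 2F 2F i k = circ a i k
  array 2F 3F i k = circᵀR b i k
  array 3F 0F i k = - circR d i k
  array 3F 1F i k = circᵀR c i k
  array 3F 2F i k = - circᵀR b i k
  array 3F 3F i k = circ a i k

  rowProduct : Fin 4 → Fin 4 → ℤ → ℤ → ℤ
  rowProduct p p' i i' = sumFin (λ q → ∑ (λ z → array p q i z * array p' q i' z))

  rowProduct-comm : ∀ p p' i i' → rowProduct p p' i i' ≡ rowProduct p' p i' i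
  rowProduct-comm p p' i i' =
    sumFin-cong λ q → ∑-cong λ z → ℤₚ.*-comm (array p q i z) (array p' q i' z)

  module _ (i i' : ℤ) where
    private
      ρ : (ℤ → ℤ) → ℤ
      ρ x = correlation x x (i - i')

    rowProduct-diagonal : ∀ p → rowProduct p p i i' ≡ autocorrelationSum seq (i - i')
    rowProduct-diagonal 0F =
      sum₄-cong (circ·circ pa pa i i') (circR·circR pb pb i i') (circR·circR pc pc i i') (circR·circR pd pd i i')
    rowProduct-diagonal 1F = trans
      (sum₄-cong (trans (∑-neg-neg (circR b i) (circR b i')) (circR·circR pb pb i i'))
                 (circ·circ pa pa i i')
                 (circᵀR·circᵀR pd pd i i')
                 (trans (∑-neg-neg (circᵀR c i) (circᵀR c i')) (circᵀR·circᵀR pc pc i i')))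
      (reorder (ρ a) (ρ b) (ρ c) (ρ d))
      where
      reorder : ∀ A B C D → B + (A + (D + (C + + 0))) ≡ A + (B + (C + (D + + 0)))
      reorder = solve-∀
    rowProduct-diagonal 2F = trans
      (sum₄-cong (trans (∑-neg-neg (circR c i) (circR c i')) (circR·circR pc pc i i'))
                 (trans (∑-neg-neg (circᵀR d i) (circᵀR d i')) (circᵀR·circᵀR pd pd i i'))
                 (circ·circ pa pa i i')
                 (circᵀR·circᵀR pb pb i i'))
      (reorder (ρ a) (ρ b) (ρ c) (ρ d))
      where
      reorder : ∀ A B C D → C + (D + (A + (B + + 0))) ≡ A + (B + (C + (D + + 0)))
      reorder = solve-∀
    rowProduct-diagonal 3F = trans
      (sum₄-cong (trans (∑-neg-neg (circR d i) (circR d i')) (circR·circR pd pd i i'))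
                 (circᵀR·circᵀR pc pc i i')
                 (trans (∑-neg-neg (circᵀR b i) (circᵀR b i')) (circᵀR·circᵀR pb pb i i'))
                 (circ·circ pa pa i i'))
      (reorder (ρ a) (ρ b) (ρ c) (ρ d))
      where
      reorder : ∀ A B C D → D + (C + (B + (A + + 0))) ≡ A + (B + (C + (D + + 0)))
      reorder = solve-∀

  rowProduct-01 : ∀ i i' → rowProduct 0F 1F i i' ≡ + 0
  rowProduct-01 i i' = trans
    (sum₄-cong
      (trans (∑-negʳ (circ a i) (circR b i')) (cong -_ (circ·circR pa pb i i')))
      (circR·circ pb pa i i')
      (circR·circᵀR pc pd i i')
      (trans (∑-negʳ (circR d i) (circᵀR c i'))
             (cong -_ (trans (circR·circᵀR pd pc i i') (convolution-comm pd pc (i' - i))))))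
    (cancel (convolution a b (- i - i' - + 1)) (convolution c d (i' - i)))
    where
    cancel : ∀ X Y → - X + (X + (Y + (- Y + + 0))) ≡ + 0
    cancel = solve-∀

  rowProduct-02 : ∀ i i' → rowProduct 0F 2F i i' ≡ + 0
  rowProduct-02 i i' = trans
    (sum₄-cong
      (trans (∑-negʳ (circ a i) (circR c i')) (cong -_ (circ·circR pa pc i i')))
      (trans (∑-negʳ (circR b i) (circᵀR d i')) (cong -_ (circR·circᵀR pb pd i i')))
      (circR·circ pc pa i i')
      (trans (circR·circᵀR pd pb i i') (convolution-comm pd pb (i' - i))))
    (cancel (convolution a c (- i - i' - + 1)) (convolution b d (i' - i)))
    where
    cancel : ∀ X Y → - X + (- Y + (X + (Y + + 0))) ≡ + 0
    cancel = solve-∀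

  rowProduct-03 : ∀ i i' → rowProduct 0F 3F i i' ≡ + 0
  rowProduct-03 i i' = trans
    (sum₄-cong
      (trans (∑-negʳ (circ a i) (circR d i')) (cong -_ (circ·circR pa pd i i')))
      (circR·circᵀR pb pc i i')
      (trans (∑-negʳ (circR c i) (circᵀR b i'))
             (cong -_ (trans (circR·circᵀR pc pb i i') (convolution-comm pc pb (i' - i)))))
      (circR·circ pd pa i i'))
    (cancel (convolution a d (- i - i' - + 1)) (convolution b c (i' - i)))
    where
    cancel : ∀ X Y → - X + (Y + (- Y + (X + + 0))) ≡ + 0
    cancel = solve-∀

  rowProduct-12 : ∀ i i' → rowProduct 1F 2F i i' ≡ + 0
  rowProduct-12 i i' = trans
    (sum₄-cong
      (trans (∑-neg-neg (circR b i) (circR c i')) (circR·circR pb pc i i'))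
      (trans (∑-negʳ (circ a i) (circᵀR d i')) (cong -_ (circ·circᵀR pa pd i i')))
      (circᵀR·circ pd pa i i')
      (trans (∑-negˡ (circᵀR c i) (circᵀR b i')) (cong -_ (circᵀR·circᵀR pc pb i i'))))
    (cancel (correlation b c (i - i')) (correlation a d (i + i' + + 1)))
    where
    cancel : ∀ X Y → X + (- Y + (Y + (- X + + 0))) ≡ + 0
    cancel = solve-∀

  rowProduct-13 : ∀ i i' → rowProduct 1F 3F i i' ≡ + 0
  rowProduct-13 i i' = trans
    (sum₄-cong
      (trans (∑-neg-neg (circR b i) (circR d i')) (circR·circR pb pd i i'))
      (circ·circᵀR pa pc i i')
      (trans (∑-negʳ (circᵀR d i) (circᵀR b i')) (cong -_ (circᵀR·circᵀR pd pb i i')))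
      (trans (∑-negˡ (circᵀR c i) (circ a i')) (cong -_ (circᵀR·circ pc pa i i'))))
    (cancel (correlation b d (i - i')) (correlation a c (i + i' + + 1)))
    where
    cancel : ∀ X Y → X + (Y + (- X + (- Y + + 0))) ≡ + 0
    cancel = solve-∀

  rowProduct-23 : ∀ i i' → rowProduct 2F 3F i i' ≡ + 0
  rowProduct-23 i i' = trans
    (sum₄-cong
      (trans (∑-neg-neg (circR c i) (circR d i')) (circR·circR pc pd i i'))
      (trans (∑-negˡ (circᵀR d i) (circᵀR c i')) (cong -_ (circᵀR·circᵀR pd pc i i')))
      (trans (∑-negʳ (circ a i) (circᵀR b i')) (cong -_ (circ·circᵀR pa pb i i')))
      (circᵀR·circ pb pa i i'))
    (cancel (correlation c d (i - i')) (correlation a b (i + i' + + 1)))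
    where
    cancel : ∀ X Y → X + (- X + (- Y + (Y + + 0))) ≡ + 0
    cancel = solve-∀

  rowProduct-offDiagonal : ∀ {p p'} → p ≢ p' → ∀ i i' → rowProduct p p' i i' ≡ + 0
  rowProduct-offDiagonal {0F} {0F} p≢p' = ⊥-elim (p≢p' refl)
  rowProduct-offDiagonal {1F} {1F} p≢p' = ⊥-elim (p≢p' refl)
  rowProduct-offDiagonal {2F} {2F} p≢p' = ⊥-elim (p≢p' refl)
  rowProduct-offDiagonal {3F} {3F} p≢p' = ⊥-elim (p≢p' refl)
  rowProduct-offDiagonal {0F} {1F} _ = rowProduct-01
  rowProduct-offDiagonal {0F} {2F} _ = rowProduct-02
  rowProduct-offDiagonal {0F} {3F} _ = rowProduct-03
  rowProduct-offDiagonal {1F} {2F} _ = rowProduct-12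
  rowProduct-offDiagonal {1F} {3F} _ = rowProduct-13
  rowProduct-offDiagonal {2F} {3F} _ = rowProduct-23
  rowProduct-offDiagonal {1F} {0F} _ i i' = trans (rowProduct-comm 1F 0F i i') (rowProduct-01 i' i)
  rowProduct-offDiagonal {2F} {0F} _ i i' = trans (rowProduct-comm 2F 0F i i') (rowProduct-02 i' i)
  rowProduct-offDiagonal {3F} {0F} _ i i' = trans (rowProduct-comm 3F 0F i i') (rowProduct-03 i' i)
  rowProduct-offDiagonal {2F} {1F} _ i i' = trans (rowProduct-comm 2F 1F i i') (rowProduct-12 i' i)
  rowProduct-offDiagonal {3F} {1F} _ i i' = trans (rowProduct-comm 3F 1F i i') (rowProduct-13 i' i)
  rowProduct-offDiagonal {3F} {2F} _ i i' = trans (rowProduct-comm 3F 2F i i') (rowProduct-23 i' i)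

  circR-symmetric : ∀ x i k → circR x i k ≡ circR x k i
  circR-symmetric x i k = cong x (swap i k)
    where
    swap : ∀ i k → - i - + 1 - k ≡ - k - + 1 - i
    swap = solve-∀

  circᵀR-symmetric : ∀ x i k → circᵀR x i k ≡ circᵀR x k i
  circᵀR-symmetric x i k = cong x (swap i k)
    where
    swap : ∀ i k → k + (i + + 1) ≡ i + (k + + 1)
    swap = solve-∀

  array-antisymmetric : ∀ {p q} → p ≢ q → ∀ i k → array p q i k + array q p k i ≡ + 0
  array-antisymmetric {0F} {0F} p≢q = ⊥-elim (p≢q refl)
  array-antisymmetric {1F} {1F} p≢q = ⊥-elim (p≢q refl)
  array-antisymmetric {2F} {2F} p≢q = ⊥-elim (p≢q refl)
  array-antisymmetric {3F} {3F} p≢q = ⊥-elim (p≢q refl)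
  array-antisymmetric {0F} {1F} _ i k = ℤₚ.i≡j⇒i-j≡0 (circR-symmetric b i k)
  array-antisymmetric {0F} {2F} _ i k = ℤₚ.i≡j⇒i-j≡0 (circR-symmetric c i k)
  array-antisymmetric {0F} {3F} _ i k = ℤₚ.i≡j⇒i-j≡0 (circR-symmetric d i k)
  array-antisymmetric {1F} {0F} _ i k = i≡j⇒-i+j≡0 (circR-symmetric b i k)
  array-antisymmetric {2F} {0F} _ i k = i≡j⇒-i+j≡0 (circR-symmetric c i k)
  array-antisymmetric {3F} {0F} _ i k = i≡j⇒-i+j≡0 (circR-symmetric d i k)
  array-antisymmetric {1F} {2F} _ i k = ℤₚ.i≡j⇒i-j≡0 (circᵀR-symmetric d i k)
  array-antisymmetric {2F} {1F} _ i k = i≡j⇒-i+j≡0 (circᵀR-symmetric d i k)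
  array-antisymmetric {1F} {3F} _ i k = i≡j⇒-i+j≡0 (circᵀR-symmetric c i k)
  array-antisymmetric {3F} {1F} _ i k = ℤₚ.i≡j⇒i-j≡0 (circᵀR-symmetric c i k)
  array-antisymmetric {2F} {3F} _ i k = ℤₚ.i≡j⇒i-j≡0 (circᵀR-symmetric b i k)
  array-antisymmetric {3F} {2F} _ i k = i≡j⇒-i+j≡0 (circᵀR-symmetric b i k)

  array-sign : (∀ j z → IsSign (seq j z)) → ∀ p q i k → IsSign (array p q i k)
  array-sign sign 0F 0F i k = sign 0F _
  array-sign sign 0F 1F i k = sign 1F _
  array-sign sign 0F 2F i k = sign 2F _
  array-sign sign 0F 3F i k = sign 3F _
  array-sign sign 1F 0F i k = IsSign-neg (sign 1F _)
  array-sign sign 1F 1F i k = sign 0F _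
  array-sign sign 1F 2F i k = sign 3F _
  array-sign sign 1F 3F i k = IsSign-neg (sign 2F _)
  array-sign sign 2F 0F i k = IsSign-neg (sign 2F _)
  array-sign sign 2F 1F i k = IsSign-neg (sign 3F _)
  array-sign sign 2F 2F i k = sign 0F _
  array-sign sign 2F 3F i k = sign 1F _
  array-sign sign 3F 0F i k = IsSign-neg (sign 3F _)
  array-sign sign 3F 1F i k = sign 2F _
  array-sign sign 3F 2F i k = IsSign-neg (sign 1F _)
  array-sign sign 3F 3F i k = sign 0F _

  array-diagonal : ∀ p i k → array p p i k ≡ a (k - i)
  array-diagonal 0F i k = refl
  array-diagonal 1F i k = refl
  array-diagonal 2F i k = refl
  array-diagonal 3F i k = refl

record SkewComplementarySequences (v : ℕ) : Set where
  field
    seq           : Fin 4 → ℤ → ℤ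
    periodic      : ∀ j → PeriodicSums.Periodic v (seq j)
    signs         : ∀ j z → IsSign (seq j z)
    complementary : ∀ {s} → 0 ℕ.< s → s ℕ.< v → PeriodicSums.autocorrelationSum v seq (+ s) ≡ + 0
    skew-origin   : seq 0F (+ 0) ≡ + 1
    skew          : ∀ {s} → 0 ℕ.< s → s ℕ.< v → seq 0F (+ s) + seq 0F (- + s) ≡ + 0

module GoethalsSeidelMatrix {v : ℕ} (S : SkewComplementarySequences v) where
  open SkewComplementarySequences S
  open PeriodicSums v
  open GoethalsSeidelArray seq periodic

  H : Matrix (4 ℕ.* v)
  H = blockMatrix v (λ p q i k → array p q (toℤ i) (toℤ k))

  H-combine : ∀ p i q k → H (combine p i) (combine q k) ≡ array p q (toℤ i) (toℤ k)
  H-combine = blockMatrix-combine (λ p q i k → array p q (toℤ i) (toℤ k))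

  H-entries : ∀ p i q k → IsSign (H (combine p i) (combine q k))
  H-entries p i q k = subst IsSign (sym (H-combine p i q k)) (array-sign signs p q (toℤ i) (toℤ k))

  rowProduct-identity : ∀ p i q k →
    rowProduct p q (toℤ i) (toℤ k) ≡ scale (+ (4 ℕ.* v)) identity (combine p i) (combine q k)
  rowProduct-identity p i q k with p ≟ q | i ≟ k
  ... | no p≢q | _ = trans (rowProduct-offDiagonal p≢q _ _)
    (sym (scale-identity-offDiagonal (+ (4 ℕ.* v)) (p≢q ∘ Finₚ.combine-injectiveˡ p i q k)))
  ... | yes refl | no i≢k = begin
    rowProduct p p (toℤ i) (toℤ k)
      ≡⟨ rowProduct-diagonal _ _ p ⟩
    autocorrelationSum seq (toℤ i - toℤ k)
      ≡⟨ differences-vanish complementary (autocorrelationSum-even periodic) i≢k ⟩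
    + 0
      ≡⟨ scale-identity-offDiagonal (+ (4 ℕ.* v)) (i≢k ∘ Finₚ.combine-injectiveʳ p i p k) ⟨
    scale (+ (4 ℕ.* v)) identity (combine p i) (combine p k) ∎
  ... | yes refl | yes refl = begin
    rowProduct p p (toℤ i) (toℤ i)
      ≡⟨ rowProduct-diagonal _ _ p ⟩
    autocorrelationSum seq (toℤ i - toℤ i)
      ≡⟨ cong (autocorrelationSum seq) (ℤₚ.i≡j⇒i-j≡0 {toℤ i} refl) ⟩
    autocorrelationSum seq (+ 0)
      ≡⟨ autocorrelationSum-zero signs ⟩
    + (4 ℕ.* v)
      ≡⟨ scale-identity-diagonal (+ (4 ℕ.* v)) (combine p i) ⟨
    scale (+ (4 ℕ.* v)) identity (combine p i) (combine p i) ∎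

  H-hadamard : ∀ p i q k →
    (H ⊗ transpose H) (combine p i) (combine q k) ≡ scale (+ (4 ℕ.* v)) identity (combine p i) (combine q k)
  H-hadamard p i q k = begin
    (H ⊗ transpose H) (combine p i) (combine q k)
      ≡⟨ blockMatrix-⊗-transpose (λ p q i k → array p q (toℤ i) (toℤ k)) p i q k ⟩
    sumFin (λ r → sumFin (λ l → array p r (toℤ i) (toℤ l) * array q r (toℤ k) (toℤ l)))
      ≡⟨ sumFin-cong (λ r → ∑-toℤ (λ z → array p r (toℤ i) z * array q r (toℤ k) z)) ⟩
    rowProduct p q (toℤ i) (toℤ k)
      ≡⟨ rowProduct-identity p i q k ⟩
    scale (+ (4 ℕ.* v)) identity (combine p i) (combine q k) ∎

  array-skew-identity : ∀ p i q k →
    array p q (toℤ i) (toℤ k) + array q p (toℤ k) (toℤ i) ≡ scale (+ 2) identity (combine p i) (combine q k)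
  array-skew-identity p i q k with p ≟ q | i ≟ k
  ... | no p≢q | _ = trans (array-antisymmetric p≢q _ _)
    (sym (scale-identity-offDiagonal (+ 2) (p≢q ∘ Finₚ.combine-injectiveˡ p i q k)))
  ... | yes refl | no i≢k = begin
    array p p (toℤ i) (toℤ k) + array p p (toℤ k) (toℤ i)
      ≡⟨ cong₂ _+_ (array-diagonal p _ _) (array-diagonal p _ _) ⟩
    a (toℤ k - toℤ i) + a (toℤ i - toℤ k)
      ≡⟨ cong (λ t → a (toℤ k - toℤ i) + a t) (i-j≡-[j-i] (toℤ i) (toℤ k)) ⟩
    a (toℤ k - toℤ i) + a (- (toℤ k - toℤ i))
      ≡⟨ differences-vanish skew (symmetrisation-even a) (i≢k ∘ sym) ⟩
    + 0
      ≡⟨ scale-identity-offDiagonal (+ 2) (i≢k ∘ Finₚ.combine-injectiveʳ p i p k) ⟨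
    scale (+ 2) identity (combine p i) (combine p k) ∎
  ... | yes refl | yes refl = begin
    array p p (toℤ i) (toℤ i) + array p p (toℤ i) (toℤ i)
      ≡⟨ cong₂ _+_ (array-diagonal p _ _) (array-diagonal p _ _) ⟩
    a (toℤ i - toℤ i) + a (toℤ i - toℤ i)
      ≡⟨ cong (λ t → a t + a t) (ℤₚ.i≡j⇒i-j≡0 {toℤ i} refl) ⟩
    a (+ 0) + a (+ 0)
      ≡⟨ cong (λ t → t + t) skew-origin ⟩
    + 2
      ≡⟨ scale-identity-diagonal (+ 2) (combine p i) ⟨
    scale (+ 2) identity (combine p i) (combine p i) ∎

  H-skew : ∀ p i q k →
    (H ⊕ transpose H) (combine p i) (combine q k) ≡ scale (+ 2) identity (combine p i) (combine q k)
  H-skew p i q k =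
    trans (cong₂ _+_ (H-combine p i q k) (H-combine q k p i)) (array-skew-identity p i q k)

goethalsSeidel : ∀ {v} → SkewComplementarySequences v → SkewHadamardExists (4 ℕ.* v)
goethalsSeidel S = H , record
  { entries  = ∀-combine H-entries
  ; hadamard = ∀-combine H-hadamard
  ; skew     = ∀-combine H-skew
  }
  where open GoethalsSeidelMatrix S

module Residues (w : ℕ) where

  residue : ℤ → ℕ
  residue (+ n)    = n % suc w
  residue -[1+ n ] = w ∸ n % suc w

  residue-periodic : ∀ z → residue (z + + suc w) ≡ residue z
  residue-periodic (+ n)    = [m+n]%n≡m%n n (suc w)
  residue-periodic -[1+ n ] with n ℕ.<? suc w
  ... | yes n<v = begin
    residue (suc w ⊖ suc n)      ≡⟨ cong residue (ℤₚ.⊖-≥ n<v) ⟩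
    residue (+ (suc w ∸ suc n))  ≡⟨ m<n⇒m%n≡m (ℕ.s≤s (ℕₚ.m∸n≤m w n)) ⟩
    w ∸ n                        ≡⟨ cong (w ∸_) (m<n⇒m%n≡m n<v) ⟨
    w ∸ n % suc w                ∎
  ... | no n≮v = begin
    residue (suc w ⊖ suc n)              ≡⟨ cong residue (ℤₚ.⊖-< (ℕ.s≤s v≤n)) ⟩
    residue (- + (suc n ∸ suc w))        ≡⟨ cong (λ m → residue (- + m)) (ℕₚ.+-∸-assoc 1 v≤n) ⟩
    w ∸ (n ∸ suc w) % suc w              ≡⟨ cong (w ∸_) ([m+n]%n≡m%n (n ∸ suc w) (suc w)) ⟨
    w ∸ (n ∸ suc w ℕ.+ suc w) % suc w    ≡⟨ cong (λ m → w ∸ m % suc w) (ℕₚ.m∸n+n≡m v≤n) ⟩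
    w ∸ n % suc w                        ∎
    where
    v≤n : suc w ℕ.≤ n
    v≤n = ℕₚ.≮⇒≥ n≮v

data SignTree : Set where
  ⁺ ⁻  : SignTree
  node : SignTree → SignTree → SignTree

-- Position n is found by reading the binary digits of n from the least significant one,
-- so that a lookup costs O(log n) during the computational checks below.
lookupSign : SignTree → ℕ → ℤ
lookupSign ⁺          n = + 1
lookupSign ⁻          n = -[1+ 0 ]
lookupSign (node l r) n with n % 2
... | zero  = lookupSign l (n / 2)
... | suc _ = lookupSign r (n / 2)

lookupSign-sign : ∀ t n → IsSign (lookupSign t n)
lookupSign-sign ⁺          n = inj₁ refl
lookupSign-sign ⁻          n = inj₂ refl
lookupSign-sign (node l r) n with n % 2
... | zero  = lookupSign-sign l (n / 2)
... | suc _ = lookupSign-sign r (n / 2)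

isZero : ℤ → Bool
isZero (+ zero) = true
isZero _        = false

allZeroUpTo : ℕ → (ℕ → ℤ) → Bool
allZeroUpTo zero    F = true
allZeroUpTo (suc n) F = isZero (F (suc n)) ∧ allZeroUpTo n F

allZeroUpTo-sound : ∀ n F → allZeroUpTo n F ≡ true → ∀ {s} → 0 ℕ.< s → s ℕ.< suc n → F s ≡ + 0
allZeroUpTo-sound zero    F _     (ℕ.s≤s _) (ℕ.s≤s ())
allZeroUpTo-sound (suc n) F check 0<s (ℕ.s≤s s≤1+n) with ℕₚ.m≤n⇒m<n∨m≡n s≤1+n
... | inj₁ s<1+n = allZeroUpTo-sound n F (∧-conicalʳ _ _ check) 0<s s<1+n
... | inj₂ refl  = isZero-sound (F (suc n)) (∧-conicalˡ _ _ check)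
  where
  isZero-sound : ∀ z → isZero z ≡ true → z ≡ + 0
  isZero-sound (+ zero) _ = refl

signTree : Fin 4 → SignTree
signTree 0F = node (node (node (node (node (node (node (node (node ⁺ ⁻) (node ⁻ ⁺)) (node (node ⁺ ⁺) (node ⁺ ⁺))) (node (node (node ⁺ ⁻) (node ⁻ ⁺)) (node (node ⁺ ⁺) (node ⁺ ⁺)))) (node (node (node (node ⁺ ⁺) (node ⁻ ⁺)) (node (node ⁺ ⁺) (node ⁻ ⁺))) (node (node (node ⁻ ⁻) (node ⁺ ⁺)) (node (node ⁻ ⁺) (node ⁻ ⁺))))) (node (node (node (node (node ⁺ ⁻) (node ⁻ ⁺)) (node (node ⁻ ⁺) (node ⁺ ⁺))) (node (node (node ⁻ ⁺) (node ⁻ ⁺)) (node (node ⁻ ⁺) (node ⁺ ⁺)))) (node (node (node (node ⁻ ⁻) (node ⁻ ⁺)) (node (node ⁺ ⁺) (node ⁺ ⁺))) (node (node (node ⁺ ⁺) (node ⁺ ⁺)) (node (node ⁺ ⁺) (node ⁺ ⁺)))))) (node (node (node (node (node (node ⁺ ⁺) (node ⁻ ⁺)) (node (node ⁺ ⁺) (node ⁺ ⁺))) (node (node (node ⁺ ⁺) (node ⁻ ⁺)) (node (node ⁺ ⁺) (node ⁺ ⁺)))) (node (node (node (node ⁻ ⁺) (node ⁻ ⁺)) (node (node ⁺ ⁺) (node ⁻ ⁺))) (node (node (node ⁻ ⁺) (node ⁺ ⁺)) (node (node ⁺ ⁺) (node ⁺ ⁺))))) (node (node (node (node (node ⁻ ⁻)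 (node ⁻ ⁺)) (node (node ⁻ ⁺) (node ⁻ ⁺))) (node (node (node ⁻ ⁺) (node ⁺ ⁺)) (node (node ⁺ ⁺) (node ⁻ ⁺)))) (node (node (node (node ⁺ ⁺) (node ⁺ ⁺)) (node (node ⁺ ⁺) (node ⁻ ⁺))) (node (node (node ⁻ ⁺) (node ⁺ ⁺)) (node (node ⁻ ⁺) (node ⁻ ⁺))))))) (node (node (node (node (node (node (node ⁺ ⁺) (node ⁺ ⁺)) (node (node ⁻ ⁺) (node ⁻ ⁺))) (node (node (node ⁺ ⁻) (node ⁻ ⁺)) (node (node ⁺ ⁺) (node ⁺ ⁺)))) (node (node (node (node ⁺ ⁻) (node ⁻ ⁺)) (node (node ⁺ ⁺) (node ⁺ ⁺))) (node (node (node ⁺ ⁻) (node ⁺ ⁺)) (node (node ⁺ ⁺) (node ⁻ ⁺))))) (node (node (node (node (node ⁺ ⁺) (node ⁻ ⁺)) (node (node ⁺ ⁺) (node ⁻ ⁺))) (node (node (node ⁻ ⁻) (node ⁻ ⁺)) (node (node ⁺ ⁺) (node ⁻ ⁺)))) (node (node (node (node ⁻ ⁺) (node ⁻ ⁺)) (node (node ⁻ ⁺) (node ⁻ ⁺))) (node (node (node ⁻ ⁺) (node ⁻ ⁺)) (node (node ⁻ ⁺) (node ⁺ ⁺)))))) (node (node (node (node (node (node ⁻ ⁺) (node ⁺ ⁺)) (node (node ⁻ ⁺) (node ⁺ ⁺))) (node (node (node ⁻ ⁻) (node ⁺ ⁺)) (node (node ⁺ ⁺) (node ⁻ ⁺))))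 (node (node (node (node ⁻ ⁺) (node ⁻ ⁺)) (node (node ⁺ ⁺) (node ⁻ ⁺))) (node (node (node ⁺ ⁺) (node ⁻ ⁺)) (node (node ⁺ ⁺) (node ⁻ ⁺))))) (node (node (node (node (node ⁻ ⁺) (node ⁺ ⁺)) (node (node ⁺ ⁺) (node ⁺ ⁺))) (node (node (node ⁻ ⁺) (node ⁻ ⁺)) (node (node ⁺ ⁺) (node ⁺ ⁺)))) (node (node (node (node ⁺ ⁺) (node ⁻ ⁺)) (node (node ⁺ ⁺) (node ⁻ ⁺))) (node (node (node ⁺ ⁺) (node ⁻ ⁺)) (node (node ⁺ ⁺) (node ⁻ ⁺)))))))) (node (node (node (node (node (node (node (node ⁻ ⁻) (node ⁻ ⁺)) (node (node ⁻ ⁺) (node ⁻ ⁺))) (node (node (node ⁺ ⁺) (node ⁺ ⁺)) (node (node ⁻ ⁺) (node ⁻ ⁺)))) (node (node (node (node ⁻ ⁺) (node ⁺ ⁺)) (node (node ⁻ ⁺) (node ⁺ ⁺))) (node (node (node ⁺ ⁻) (node ⁺ ⁺)) (node (node ⁻ ⁺) (node ⁺ ⁺))))) (node (node (node (node (node ⁺ ⁺) (node ⁻ ⁺)) (node (node ⁺ ⁺) (node ⁺ ⁺))) (node (node (node ⁻ ⁻) (node ⁺ ⁺)) (node (node ⁺ ⁺) (node ⁻ ⁺)))) (node (node (node (node ⁺ ⁻) (node ⁺ ⁺)) (node (node ⁻ ⁺) (node ⁻ ⁺))) (node (node (node ⁺ ⁺) (node ⁺ ⁺)) (node (node ⁻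 ⁺) (node ⁻ ⁺)))))) (node (node (node (node (node (node ⁻ ⁺) (node ⁻ ⁺)) (node (node ⁻ ⁺) (node ⁻ ⁺))) (node (node (node ⁻ ⁺) (node ⁺ ⁺)) (node (node ⁺ ⁺) (node ⁻ ⁺)))) (node (node (node (node ⁻ ⁻) (node ⁺ ⁺)) (node (node ⁻ ⁺) (node ⁻ ⁺))) (node (node (node ⁻ ⁻) (node ⁺ ⁺)) (node (node ⁻ ⁺) (node ⁻ ⁺))))) (node (node (node (node (node ⁻ ⁺) (node ⁻ ⁺)) (node (node ⁺ ⁺) (node ⁻ ⁺))) (node (node (node ⁺ ⁺) (node ⁺ ⁺)) (node (node ⁺ ⁺) (node ⁺ ⁺)))) (node (node (node (node ⁻ ⁻) (node ⁻ ⁺)) (node (node ⁺ ⁺) (node ⁻ ⁺))) (node (node (node ⁺ ⁺) (node ⁺ ⁺)) (node (node ⁻ ⁺) (node ⁺ ⁺))))))) (node (node (node (node (node (node (node ⁻ ⁻) (node ⁺ ⁺)) (node (node ⁺ ⁺) (node ⁻ ⁺))) (node (node (node ⁻ ⁺) (node ⁺ ⁺)) (node (node ⁺ ⁺) (node ⁻ ⁺)))) (node (node (node (node ⁺ ⁺) (node ⁻ ⁺)) (node (node ⁺ ⁺) (node ⁻ ⁺))) (node (node (node ⁻ ⁺) (node ⁻ ⁺)) (node (node ⁻ ⁺) (node ⁺ ⁺))))) (node (node (node (node (node ⁻ ⁺) (node ⁺ ⁺)) (node (node ⁻ ⁺) (node ⁻ ⁺))) (node (node (node ⁻ ⁺)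 (node ⁻ ⁺)) (node (node ⁻ ⁺) (node ⁻ ⁺)))) (node (node (node (node ⁻ ⁻) (node ⁺ ⁺)) (node (node ⁺ ⁺) (node ⁻ ⁺))) (node (node (node ⁺ ⁺) (node ⁻ ⁺)) (node (node ⁺ ⁺) (node ⁻ ⁺)))))) (node (node (node (node (node (node ⁺ ⁻) (node ⁻ ⁺)) (node (node ⁺ ⁺) (node ⁻ ⁺))) (node (node (node ⁺ ⁻) (node ⁺ ⁺)) (node (node ⁻ ⁺) (node ⁻ ⁺)))) (node (node (node (node ⁺ ⁻) (node ⁺ ⁺)) (node (node ⁻ ⁺) (node ⁻ ⁺))) (node (node (node ⁻ ⁻) (node ⁻ ⁺)) (node (node ⁺ ⁺) (node ⁺ ⁺))))) (node (node (node (node (node ⁺ ⁺) (node ⁺ ⁺)) (node (node ⁺ ⁺) (node ⁻ ⁺))) (node (node (node ⁻ ⁻) (node ⁺ ⁺)) (node (node ⁺ ⁺) (node ⁻ ⁺)))) (node (node (node (node ⁻ ⁺) (node ⁺ ⁺)) (node (node ⁺ ⁺) (node ⁺ ⁺))) (node (node (node ⁻ ⁺) (node ⁺ ⁺)) (node (node ⁺ ⁺) (node ⁺ ⁺))))))))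
signTree 1F = node (node (node (node (node (node (node (node (node ⁺ ⁻) (node ⁺ ⁺)) (node (node ⁺ ⁺) (node ⁺ ⁺))) (node (node (node ⁺ ⁺) (node ⁻ ⁺)) (node (node ⁻ ⁺) (node ⁻ ⁺)))) (node (node (node (node ⁻ ⁻) (node ⁻ ⁺)) (node (node ⁺ ⁺) (node ⁺ ⁺))) (node (node (node ⁺ ⁺) (node ⁺ ⁺)) (node (node ⁻ ⁺) (node ⁻ ⁺))))) (node (node (node (node (node ⁺ ⁺) (node ⁻ ⁺)) (node (node ⁺ ⁺) (node ⁺ ⁺))) (node (node (node ⁻ ⁻) (node ⁻ ⁺)) (node (node ⁺ ⁺) (node ⁺ ⁺)))) (node (node (node (node ⁺ ⁺) (node ⁺ ⁺)) (node (node ⁻ ⁺) (node ⁺ ⁺))) (node (node (node ⁻ ⁺) (node ⁻ ⁺)) (node (node ⁻ ⁺) (node ⁻ ⁺)))))) (node (node (node (node (node (node ⁺ ⁻) (node ⁻ ⁺)) (node (node ⁻ ⁺) (node ⁺ ⁺))) (node (node (node ⁺ ⁺) (node ⁺ ⁺)) (node (node ⁺ ⁺) (node ⁻ ⁺)))) (node (node (node (node ⁻ ⁺) (node ⁻ ⁺)) (node (node ⁺ ⁺) (node ⁻ ⁺))) (node (node (node ⁺ ⁻) (node ⁻ ⁺)) (node (node ⁻ ⁺) (node ⁺ ⁺))))) (node (node (node (node (node ⁺ ⁻) (node ⁺ ⁺)) (node (node ⁻ ⁺) (node ⁻ ⁺))) (node (node (node ⁺ ⁻) (node ⁻ ⁺))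 (node (node ⁺ ⁺) (node ⁻ ⁺)))) (node (node (node (node ⁺ ⁺) (node ⁺ ⁺)) (node (node ⁺ ⁺) (node ⁻ ⁺))) (node (node (node ⁻ ⁺) (node ⁻ ⁺)) (node (node ⁻ ⁺) (node ⁻ ⁺))))))) (node (node (node (node (node (node (node ⁻ ⁺) (node ⁺ ⁺)) (node (node ⁺ ⁺) (node ⁺ ⁺))) (node (node (node ⁺ ⁻) (node ⁺ ⁺)) (node (node ⁻ ⁺) (node ⁻ ⁺)))) (node (node (node (node ⁺ ⁺) (node ⁺ ⁺)) (node (node ⁻ ⁺) (node ⁺ ⁺))) (node (node (node ⁻ ⁻) (node ⁻ ⁺)) (node (node ⁺ ⁺) (node ⁺ ⁺))))) (node (node (node (node (node ⁻ ⁻) (node ⁻ ⁺)) (node (node ⁻ ⁺) (node ⁻ ⁺))) (node (node (node ⁻ ⁻) (node ⁺ ⁺)) (node (node ⁺ ⁺) (node ⁺ ⁺)))) (node (node (node (node ⁻ ⁺) (node ⁻ ⁺)) (node (node ⁻ ⁺) (node ⁻ ⁺))) (node (node (node ⁺ ⁺) (node ⁺ ⁺)) (node (node ⁺ ⁺) (node ⁺ ⁺)))))) (node (node (node (node (node (node ⁺ ⁻) (node ⁻ ⁺)) (node (node ⁺ ⁺) (node ⁺ ⁺))) (node (node (node ⁺ ⁺) (node ⁺ ⁺)) (node (node ⁺ ⁺) (node ⁺ ⁺)))) (node (node (node (node ⁺ ⁺) (node ⁺ ⁺)) (node (node ⁺ ⁺) (node ⁻ ⁺))) (node (node (node ⁻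 ⁺) (node ⁻ ⁺)) (node (node ⁻ ⁺) (node ⁻ ⁺))))) (node (node (node (node (node ⁺ ⁻) (node ⁻ ⁺)) (node (node ⁻ ⁺) (node ⁻ ⁺))) (node (node (node ⁺ ⁻) (node ⁻ ⁺)) (node (node ⁻ ⁺) (node ⁺ ⁺)))) (node (node (node (node ⁻ ⁺) (node ⁺ ⁺)) (node (node ⁺ ⁺) (node ⁺ ⁺))) (node (node (node ⁻ ⁺) (node ⁺ ⁺)) (node (node ⁻ ⁺) (node ⁻ ⁺)))))))) (node (node (node (node (node (node (node (node ⁺ ⁻) (node ⁻ ⁺)) (node (node ⁺ ⁺) (node ⁻ ⁺))) (node (node (node ⁺ ⁺) (node ⁺ ⁺)) (node (node ⁺ ⁺) (node ⁺ ⁺)))) (node (node (node (node ⁺ ⁻) (node ⁻ ⁺)) (node (node ⁻ ⁺) (node ⁻ ⁺))) (node (node (node ⁺ ⁺) (node ⁺ ⁺)) (node (node ⁺ ⁺) (node ⁻ ⁺))))) (node (node (node (node (node ⁻ ⁺) (node ⁻ ⁺)) (node (node ⁻ ⁺) (node ⁺ ⁺))) (node (node (node ⁻ ⁺) (node ⁺ ⁺)) (node (node ⁺ ⁺) (node ⁻ ⁺)))) (node (node (node (node ⁺ ⁺) (node ⁻ ⁺)) (node (node ⁻ ⁺) (node ⁺ ⁺))) (node (node (node ⁺ ⁺) (node ⁻ ⁺)) (node (node ⁻ ⁺) (node ⁺ ⁺)))))) (node (node (node (node (node (node ⁻ ⁺) (node ⁻ ⁺)) (node (node ⁻ ⁺)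 (node ⁺ ⁺))) (node (node (node ⁻ ⁺) (node ⁻ ⁺)) (node (node ⁻ ⁺) (node ⁻ ⁺)))) (node (node (node (node ⁻ ⁺) (node ⁻ ⁺)) (node (node ⁺ ⁺) (node ⁺ ⁺))) (node (node (node ⁻ ⁻) (node ⁺ ⁺)) (node (node ⁺ ⁺) (node ⁻ ⁺))))) (node (node (node (node (node ⁺ ⁺) (node ⁻ ⁺)) (node (node ⁺ ⁺) (node ⁻ ⁺))) (node (node (node ⁺ ⁻) (node ⁺ ⁺)) (node (node ⁻ ⁺) (node ⁺ ⁺)))) (node (node (node (node ⁺ ⁻) (node ⁺ ⁺)) (node (node ⁻ ⁺) (node ⁻ ⁺))) (node (node (node ⁻ ⁺) (node ⁻ ⁺)) (node (node ⁻ ⁺) (node ⁺ ⁺))))))) (node (node (node (node (node (node (node ⁻ ⁺) (node ⁺ ⁺)) (node (node ⁺ ⁺) (node ⁻ ⁺))) (node (node (node ⁺ ⁺) (node ⁺ ⁺)) (node (node ⁺ ⁺) (node ⁻ ⁺)))) (node (node (node (node ⁺ ⁻) (node ⁺ ⁺)) (node (node ⁻ ⁺) (node ⁻ ⁺))) (node (node (node ⁻ ⁺) (node ⁻ ⁺)) (node (node ⁺ ⁺) (node ⁻ ⁺))))) (node (node (node (node (node ⁺ ⁻) (node ⁺ ⁺)) (node (node ⁺ ⁺) (node ⁻ ⁺))) (node (node (node ⁺ ⁻) (node ⁺ ⁺)) (node (node ⁺ ⁺) (node ⁺ ⁺)))) (node (node (node (node ⁺ ⁻) (node ⁻ ⁺))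 (node (node ⁻ ⁺) (node ⁻ ⁺))) (node (node (node ⁺ ⁺) (node ⁻ ⁺)) (node (node ⁻ ⁺) (node ⁻ ⁺)))))) (node (node (node (node (node (node ⁻ ⁺) (node ⁻ ⁺)) (node (node ⁺ ⁺) (node ⁺ ⁺))) (node (node (node ⁺ ⁺) (node ⁻ ⁺)) (node (node ⁺ ⁺) (node ⁻ ⁺)))) (node (node (node (node ⁻ ⁻) (node ⁺ ⁺)) (node (node ⁺ ⁺) (node ⁺ ⁺))) (node (node (node ⁻ ⁺) (node ⁻ ⁺)) (node (node ⁻ ⁺) (node ⁻ ⁺))))) (node (node (node (node (node ⁺ ⁻) (node ⁺ ⁺)) (node (node ⁺ ⁺) (node ⁻ ⁺))) (node (node (node ⁺ ⁺) (node ⁻ ⁺)) (node (node ⁻ ⁺) (node ⁻ ⁺)))) (node (node (node (node ⁻ ⁺) (node ⁻ ⁺)) (node (node ⁻ ⁺) (node ⁻ ⁺))) (node (node (node ⁻ ⁺) (node ⁻ ⁺)) (node (node ⁻ ⁺) (node ⁺ ⁺))))))))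
signTree 2F = node (node (node (node (node (node (node (node (node ⁻ ⁺) (node ⁺ ⁺)) (node (node ⁺ ⁺) (node ⁺ ⁺))) (node (node (node ⁻ ⁻) (node ⁻ ⁺)) (node (node ⁻ ⁺) (node ⁻ ⁺)))) (node (node (node (node ⁻ ⁻) (node ⁺ ⁺)) (node (node ⁺ ⁺) (node ⁺ ⁺))) (node (node (node ⁻ ⁻) (node ⁺ ⁺)) (node (node ⁺ ⁺) (node ⁺ ⁺))))) (node (node (node (node (node ⁻ ⁻) (node ⁺ ⁺)) (node (node ⁺ ⁺) (node ⁺ ⁺))) (node (node (node ⁺ ⁺) (node ⁻ ⁺)) (node (node ⁻ ⁺) (node ⁺ ⁺)))) (node (node (node (node ⁺ ⁻) (node ⁻ ⁺)) (node (node ⁻ ⁺) (node ⁻ ⁺))) (node (node (node ⁻ ⁺) (node ⁻ ⁺)) (node (node ⁻ ⁺) (node ⁺ ⁺)))))) (node (node (node (node (node (node ⁺ ⁻) (node ⁺ ⁺)) (node (node ⁻ ⁺) (node ⁻ ⁺))) (node (node (node ⁺ ⁺) (node ⁻ ⁺)) (node (node ⁻ ⁺) (node ⁻ ⁺)))) (node (node (node (node ⁺ ⁺) (node ⁺ ⁺)) (node (node ⁺ ⁺) (node ⁻ ⁺))) (node (node (node ⁻ ⁺) (node ⁺ ⁺)) (node (node ⁻ ⁺) (node ⁺ ⁺))))) (node (node (node (node (node ⁻ ⁺) (node ⁺ ⁺)) (node (node ⁺ ⁺) (node ⁻ ⁺))) (node (node (node ⁻ ⁻) (node ⁻ ⁺))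 (node (node ⁺ ⁺) (node ⁺ ⁺)))) (node (node (node (node ⁺ ⁻) (node ⁻ ⁺)) (node (node ⁺ ⁺) (node ⁺ ⁺))) (node (node (node ⁺ ⁺) (node ⁻ ⁺)) (node (node ⁺ ⁺) (node ⁺ ⁺))))))) (node (node (node (node (node (node (node ⁻ ⁺) (node ⁺ ⁺)) (node (node ⁺ ⁺) (node ⁻ ⁺))) (node (node (node ⁺ ⁺) (node ⁻ ⁺)) (node (node ⁻ ⁺) (node ⁻ ⁺)))) (node (node (node (node ⁻ ⁻) (node ⁻ ⁺)) (node (node ⁺ ⁺) (node ⁺ ⁺))) (node (node (node ⁻ ⁺) (node ⁺ ⁺)) (node (node ⁻ ⁺) (node ⁻ ⁺))))) (node (node (node (node (node ⁺ ⁺) (node ⁺ ⁺)) (node (node ⁻ ⁺) (node ⁺ ⁺))) (node (node (node ⁺ ⁺) (node ⁺ ⁺)) (node (node ⁺ ⁺) (node ⁻ ⁺)))) (node (node (node (node ⁺ ⁺) (node ⁻ ⁺)) (node (node ⁻ ⁺) (node ⁺ ⁺))) (node (node (node ⁻ ⁺) (node ⁻ ⁺)) (node (node ⁻ ⁺) (node ⁺ ⁺)))))) (node (node (node (node (node (node ⁻ ⁻) (node ⁻ ⁺)) (node (node ⁻ ⁺) (node ⁻ ⁺))) (node (node (node ⁺ ⁻) (node ⁻ ⁺)) (node (node ⁺ ⁺) (node ⁻ ⁺)))) (node (node (node (node ⁺ ⁻) (node ⁻ ⁺)) (node (node ⁺ ⁺) (node ⁺ ⁺))) (node (node (node ⁻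 ⁺) (node ⁺ ⁺)) (node (node ⁻ ⁺) (node ⁺ ⁺))))) (node (node (node (node (node ⁻ ⁺) (node ⁻ ⁺)) (node (node ⁻ ⁺) (node ⁻ ⁺))) (node (node (node ⁻ ⁻) (node ⁺ ⁺)) (node (node ⁻ ⁺) (node ⁻ ⁺)))) (node (node (node (node ⁻ ⁺) (node ⁺ ⁺)) (node (node ⁺ ⁺) (node ⁻ ⁺))) (node (node (node ⁻ ⁺) (node ⁻ ⁺)) (node (node ⁻ ⁺) (node ⁺ ⁺)))))))) (node (node (node (node (node (node (node (node ⁻ ⁺) (node ⁺ ⁺)) (node (node ⁻ ⁺) (node ⁻ ⁺))) (node (node (node ⁺ ⁻) (node ⁻ ⁺)) (node (node ⁻ ⁺) (node ⁺ ⁺)))) (node (node (node (node ⁻ ⁻) (node ⁻ ⁺)) (node (node ⁺ ⁺) (node ⁻ ⁺))) (node (node (node ⁻ ⁻) (node ⁺ ⁺)) (node (node ⁻ ⁺) (node ⁻ ⁺))))) (node (node (node (node (node ⁻ ⁺) (node ⁺ ⁺)) (node (node ⁺ ⁺) (node ⁺ ⁺))) (node (node (node ⁻ ⁻) (node ⁺ ⁺)) (node (node ⁻ ⁺) (node ⁺ ⁺)))) (node (node (node (node ⁻ ⁺) (node ⁻ ⁺)) (node (node ⁻ ⁺) (node ⁺ ⁺))) (node (node (node ⁺ ⁺) (node ⁻ ⁺)) (node (node ⁺ ⁺) (node ⁻ ⁺)))))) (node (node (node (node (node (node ⁺ ⁻) (node ⁺ ⁺)) (node (node ⁺ ⁺)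 (node ⁺ ⁺))) (node (node (node ⁺ ⁺) (node ⁺ ⁺)) (node (node ⁻ ⁺) (node ⁺ ⁺)))) (node (node (node (node ⁺ ⁻) (node ⁺ ⁺)) (node (node ⁻ ⁺) (node ⁺ ⁺))) (node (node (node ⁺ ⁺) (node ⁺ ⁺)) (node (node ⁺ ⁺) (node ⁺ ⁺))))) (node (node (node (node (node ⁺ ⁺) (node ⁺ ⁺)) (node (node ⁺ ⁺) (node ⁺ ⁺))) (node (node (node ⁺ ⁻) (node ⁻ ⁺)) (node (node ⁻ ⁺) (node ⁺ ⁺)))) (node (node (node (node ⁺ ⁺) (node ⁺ ⁺)) (node (node ⁺ ⁺) (node ⁺ ⁺))) (node (node (node ⁺ ⁺) (node ⁺ ⁺)) (node (node ⁺ ⁺) (node ⁺ ⁺))))))) (node (node (node (node (node (node (node ⁺ ⁺) (node ⁺ ⁺)) (node (node ⁺ ⁺) (node ⁺ ⁺))) (node (node (node ⁻ ⁻) (node ⁺ ⁺)) (node (node ⁺ ⁺) (node ⁺ ⁺)))) (node (node (node (node ⁺ ⁻) (node ⁺ ⁺)) (node (node ⁻ ⁺) (node ⁺ ⁺))) (node (node (node ⁺ ⁻) (node ⁺ ⁺)) (node (node ⁻ ⁺) (node ⁻ ⁺))))) (node (node (node (node (node ⁻ ⁺) (node ⁺ ⁺)) (node (node ⁺ ⁺) (node ⁻ ⁺))) (node (node (node ⁻ ⁺) (node ⁻ ⁺)) (node (node ⁺ ⁺) (node ⁻ ⁺)))) (node (node (node (node ⁻ ⁺) (node ⁻ ⁺))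 (node (node ⁺ ⁺) (node ⁺ ⁺))) (node (node (node ⁺ ⁺) (node ⁻ ⁺)) (node (node ⁺ ⁺) (node ⁻ ⁺)))))) (node (node (node (node (node (node ⁺ ⁻) (node ⁺ ⁺)) (node (node ⁻ ⁺) (node ⁻ ⁺))) (node (node (node ⁻ ⁺) (node ⁺ ⁺)) (node (node ⁻ ⁺) (node ⁺ ⁺)))) (node (node (node (node ⁺ ⁺) (node ⁻ ⁺)) (node (node ⁺ ⁺) (node ⁻ ⁺))) (node (node (node ⁺ ⁺) (node ⁺ ⁺)) (node (node ⁻ ⁺) (node ⁻ ⁺))))) (node (node (node (node (node ⁺ ⁻) (node ⁻ ⁺)) (node (node ⁺ ⁺) (node ⁺ ⁺))) (node (node (node ⁻ ⁻) (node ⁻ ⁺)) (node (node ⁺ ⁺) (node ⁻ ⁺)))) (node (node (node (node ⁺ ⁺) (node ⁻ ⁺)) (node (node ⁺ ⁺) (node ⁻ ⁺))) (node (node (node ⁺ ⁺) (node ⁺ ⁺)) (node (node ⁺ ⁺) (node ⁺ ⁺))))))))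
signTree 3F = node (node (node (node (node (node (node (node (node ⁻ ⁺) (node ⁻ ⁺)) (node (node ⁺ ⁺) (node ⁻ ⁺))) (node (node (node ⁺ ⁺) (node ⁻ ⁺)) (node (node ⁺ ⁺) (node ⁺ ⁺)))) (node (node (node (node ⁺ ⁺) (node ⁺ ⁺)) (node (node ⁻ ⁺) (node ⁻ ⁺))) (node (node (node ⁻ ⁺) (node ⁻ ⁺)) (node (node ⁺ ⁺) (node ⁺ ⁺))))) (node (node (node (node (node ⁻ ⁺) (node ⁺ ⁺)) (node (node ⁻ ⁺) (node ⁺ ⁺))) (node (node (node ⁻ ⁺) (node ⁻ ⁺)) (node (node ⁺ ⁺) (node ⁻ ⁺)))) (node (node (node (node ⁻ ⁻) (node ⁺ ⁺)) (node (node ⁺ ⁺) (node ⁻ ⁺))) (node (node (node ⁺ ⁺) (node ⁺ ⁺)) (node (node ⁺ ⁺) (node ⁺ ⁺)))))) (node (node (node (node (node (node ⁻ ⁺) (node ⁺ ⁺)) (node (node ⁺ ⁺) (node ⁺ ⁺))) (node (node (node ⁺ ⁻) (node ⁻ ⁺)) (node (node ⁺ ⁺) (node ⁺ ⁺)))) (node (node (node (node ⁻ ⁻) (node ⁺ ⁺)) (node (node ⁻ ⁺) (node ⁻ ⁺))) (node (node (node ⁺ ⁺) (node ⁺ ⁺)) (node (node ⁺ ⁺) (node ⁻ ⁺))))) (node (node (node (node (node ⁺ ⁺) (node ⁻ ⁺)) (node (node ⁺ ⁺) (node ⁻ ⁺))) (node (node (node ⁻ ⁺) (node ⁺ ⁺))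 (node (node ⁻ ⁺) (node ⁺ ⁺)))) (node (node (node (node ⁻ ⁺) (node ⁺ ⁺)) (node (node ⁻ ⁺) (node ⁺ ⁺))) (node (node (node ⁺ ⁺) (node ⁺ ⁺)) (node (node ⁺ ⁺) (node ⁺ ⁺))))))) (node (node (node (node (node (node (node ⁺ ⁻) (node ⁻ ⁺)) (node (node ⁻ ⁺) (node ⁺ ⁺))) (node (node (node ⁻ ⁺) (node ⁺ ⁺)) (node (node ⁺ ⁺) (node ⁺ ⁺)))) (node (node (node (node ⁺ ⁺) (node ⁻ ⁺)) (node (node ⁺ ⁺) (node ⁺ ⁺))) (node (node (node ⁺ ⁺) (node ⁺ ⁺)) (node (node ⁻ ⁺) (node ⁺ ⁺))))) (node (node (node (node (node ⁺ ⁺) (node ⁻ ⁺)) (node (node ⁺ ⁺) (node ⁺ ⁺))) (node (node (node ⁻ ⁻) (node ⁻ ⁺)) (node (node ⁻ ⁺) (node ⁻ ⁺)))) (node (node (node (node ⁺ ⁻) (node ⁻ ⁺)) (node (node ⁻ ⁺) (node ⁺ ⁺))) (node (node (node ⁻ ⁺) (node ⁻ ⁺)) (node (node ⁻ ⁺) (node ⁻ ⁺)))))) (node (node (node (node (node (node ⁺ ⁺) (node ⁺ ⁺)) (node (node ⁺ ⁺) (node ⁻ ⁺))) (node (node (node ⁻ ⁻) (node ⁺ ⁺)) (node (node ⁻ ⁺) (node ⁺ ⁺)))) (node (node (node (node ⁻ ⁻) (node ⁻ ⁺)) (node (node ⁻ ⁺) (node ⁺ ⁺))) (node (node (node ⁺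 ⁻) (node ⁻ ⁺)) (node (node ⁺ ⁺) (node ⁻ ⁺))))) (node (node (node (node (node ⁻ ⁺) (node ⁺ ⁺)) (node (node ⁺ ⁺) (node ⁺ ⁺))) (node (node (node ⁻ ⁺) (node ⁺ ⁺)) (node (node ⁺ ⁺) (node ⁺ ⁺)))) (node (node (node (node ⁺ ⁺) (node ⁻ ⁺)) (node (node ⁻ ⁺) (node ⁻ ⁺))) (node (node (node ⁺ ⁺) (node ⁻ ⁺)) (node (node ⁺ ⁺) (node ⁻ ⁺)))))))) (node (node (node (node (node (node (node (node ⁻ ⁻) (node ⁻ ⁺)) (node (node ⁻ ⁺) (node ⁻ ⁺))) (node (node (node ⁺ ⁺) (node ⁻ ⁺)) (node (node ⁺ ⁺) (node ⁻ ⁺)))) (node (node (node (node ⁻ ⁺) (node ⁺ ⁺)) (node (node ⁺ ⁺) (node ⁺ ⁺))) (node (node (node ⁻ ⁺) (node ⁻ ⁺)) (node (node ⁻ ⁺) (node ⁺ ⁺))))) (node (node (node (node (node ⁺ ⁺) (node ⁺ ⁺)) (node (node ⁺ ⁺) (node ⁻ ⁺))) (node (node (node ⁻ ⁺) (node ⁻ ⁺)) (node (node ⁺ ⁺) (node ⁺ ⁺)))) (node (node (node (node ⁻ ⁻) (node ⁺ ⁺)) (node (node ⁻ ⁺) (node ⁻ ⁺))) (node (node (node ⁻ ⁺) (node ⁺ ⁺)) (node (node ⁺ ⁺) (node ⁻ ⁺)))))) (node (node (node (node (node (node ⁺ ⁻) (node ⁺ ⁺)) (node (node ⁻ ⁺)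 (node ⁻ ⁺))) (node (node (node ⁺ ⁻) (node ⁺ ⁺)) (node (node ⁺ ⁺) (node ⁺ ⁺)))) (node (node (node (node ⁻ ⁻) (node ⁺ ⁺)) (node (node ⁺ ⁺) (node ⁻ ⁺))) (node (node (node ⁻ ⁺) (node ⁻ ⁺)) (node (node ⁻ ⁺) (node ⁻ ⁺))))) (node (node (node (node (node ⁻ ⁺) (node ⁻ ⁺)) (node (node ⁻ ⁺) (node ⁺ ⁺))) (node (node (node ⁻ ⁺) (node ⁺ ⁺)) (node (node ⁺ ⁺) (node ⁻ ⁺)))) (node (node (node (node ⁻ ⁻) (node ⁻ ⁺)) (node (node ⁺ ⁺) (node ⁻ ⁺))) (node (node (node ⁺ ⁺) (node ⁺ ⁺)) (node (node ⁻ ⁺) (node ⁻ ⁺))))))) (node (node (node (node (node (node (node ⁺ ⁻) (node ⁻ ⁺)) (node (node ⁻ ⁺) (node ⁻ ⁺))) (node (node (node ⁺ ⁺) (node ⁺ ⁺)) (node (node ⁻ ⁺) (node ⁻ ⁺)))) (node (node (node (node ⁺ ⁺) (node ⁻ ⁺)) (node (node ⁺ ⁺) (node ⁺ ⁺))) (node (node (node ⁻ ⁻) (node ⁻ ⁺)) (node (node ⁺ ⁺) (node ⁺ ⁺))))) (node (node (node (node (node ⁺ ⁺) (node ⁻ ⁺)) (node (node ⁻ ⁺) (node ⁻ ⁺))) (node (node (node ⁻ ⁺) (node ⁺ ⁺)) (node (node ⁻ ⁺) (node ⁺ ⁺)))) (node (node (node (node ⁻ ⁻) (node ⁺ ⁺))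 (node (node ⁺ ⁺) (node ⁻ ⁺))) (node (node (node ⁻ ⁺) (node ⁻ ⁺)) (node (node ⁺ ⁺) (node ⁻ ⁺)))))) (node (node (node (node (node (node ⁺ ⁺) (node ⁺ ⁺)) (node (node ⁻ ⁺) (node ⁺ ⁺))) (node (node (node ⁻ ⁻) (node ⁺ ⁺)) (node (node ⁻ ⁺) (node ⁺ ⁺)))) (node (node (node (node ⁺ ⁻) (node ⁻ ⁺)) (node (node ⁻ ⁺) (node ⁺ ⁺))) (node (node (node ⁺ ⁻) (node ⁻ ⁺)) (node (node ⁺ ⁺) (node ⁺ ⁺))))) (node (node (node (node (node ⁻ ⁺) (node ⁺ ⁺)) (node (node ⁺ ⁺) (node ⁺ ⁺))) (node (node (node ⁻ ⁻) (node ⁺ ⁺)) (node (node ⁺ ⁺) (node ⁻ ⁺)))) (node (node (node (node ⁺ ⁻) (node ⁺ ⁺)) (node (node ⁺ ⁺) (node ⁺ ⁺))) (node (node (node ⁺ ⁺) (node ⁺ ⁺)) (node (node ⁺ ⁺) (node ⁺ ⁺))))))))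

open Residues 312 using (residue; residue-periodic)
open PeriodicSums 313 using (autocorrelationSum)

sequence : Fin 4 → ℤ → ℤ
sequence j z = lookupSign (signTree j) (residue z)

sequence-complementary : ∀ {s} → 0 ℕ.< s → s ℕ.< 313 → autocorrelationSum sequence (+ s) ≡ + 0
sequence-complementary = allZeroUpTo-sound 312 (λ s → autocorrelationSum sequence (+ s)) refl

sequence-skew : ∀ {s} → 0 ℕ.< s → s ℕ.< 313 → sequence 0F (+ s) + sequence 0F (- + s) ≡ + 0
sequence-skew = allZeroUpTo-sound 312 (λ s → sequence 0F (+ s) + sequence 0F (- + s)) refl

sequences : SkewComplementarySequences 313
sequences = record
  { seq           = sequence
  ; periodic      = λ j z → cong (lookupSign (signTree j)) (residue-periodic z)
  ; signs         = λ j z → lookupSign-sign (signTree j) (residue z)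
  ; complementary = sequence-complementary
  ; skew-origin   = refl
  ; skew          = sequence-skew
  }

theorem3p2 : SkewHadamardExists 1252
theorem3p2 = goethalsSeidel sequences
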